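{- Let $q=p^r$ with $p$ prime and $r\ge1$, and let $k\ge2$ be an integer with $\gcd(k,r)=1$. Then the polynomial $$Q_{T,k,\mathbb{F}_q}(X)=X^k-q\sum_{l=0}^{k-2}(q-1)^lX^{k-2-l}$$ is irreducible over $\mathbb{Q}$. -}

module Defs where

open import Data.Nat as ℕ using (ℕ; zero; suc)
open import Data.Integer using (+_)
open import Data.Rational using (ℚ; 0ℚ; 1ℚ; _/_; _+_; _*_; -_)
open import Data.List using (List; []; _∷_; map; foldr; replicate; _++_; upTo)
open import Relation.Binary.PropositionalEquality using (_≡_)
open import Data.Product using (∃)
open import Data.Sum using (_⊎_)

-- Polynomials over ℚ as coefficient lists, lowest degree first.
-- Trailing zeros are allowed; equality of polynomials is coefficientwise.
Poly : Set
Poly = List ℚ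

coeff : Poly → ℕ → ℚ
coeff []       _       = 0ℚ
coeff (a ∷ _)  zero    = a
coeff (_ ∷ f)  (suc i) = coeff f i

_≈ₚ_ : Poly → Poly → Set
f ≈ₚ g = ∀ i → coeff f i ≡ coeff g i

addP : Poly → Poly → Poly
addP []       g        = g
addP (a ∷ f)  []       = a ∷ f
addP (a ∷ f)  (b ∷ g)  = (a + b) ∷ addP f g

scaleP : ℚ → Poly → Poly
scaleP c f = map (c *_) f

negP : Poly → Poly
negP f = map -_ f

subP : Poly → Poly → Poly
subP f g = addP f (negP g)

mulP : Poly → Poly → Poly
mulP []       g = []
mulP (a ∷ f)  g = addP (scaleP a g) (0ℚ ∷ mulP f g)

monomial : ℚ → ℕ → Poly
monomial c n = replicate n 0ℚ ++ (c ∷ [])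

oneP : Poly
oneP = 1ℚ ∷ []

IsUnit : Poly → Set
IsUnit f = ∃ λ u → mulP f u ≈ₚ oneP

Irreducible : Poly → Set
Irreducible f =
  (¬ (f ≈ₚ [])) × (¬ IsUnit f) ×
  (∀ g h → f ≈ₚ mulP g h → IsUnit g ⊎ IsUnit h)
  where
    open import Relation.Nullary using (¬_)
    open import Data.Product using (_×_)

ℕtoℚ : ℕ → ℚ
ℕtoℚ n = + n / 1

QPoly : ℕ → ℕ → Poly
QPoly q k =
  subP (monomial 1ℚ k)
       (scaleP (ℕtoℚ q)
         (foldr addP [] (map (λ l → monomial (ℕtoℚ ((q ℕ.∸ 1) ℕ.^ l)) (k ℕ.∸ 2 ℕ.∸ l))
                             (upTo (k ℕ.∸ 1)))))

module Submission where

-- Dumas' criterion. For a valuation v on ℚ and a slope c, let s(g) be the least value of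
-- v(gᵢ) + c·i over the coefficients of g and j(g) the largest index attaining it. Both are
-- additive under multiplication. For the trivial valuation and c = -1, j is the degree; for
-- k·v_p and c = r, with q = p^r, the leading coefficient 1 and the constant term
-- -q(q-1)^(k-2) of Q both attain s(Q) = k·r, while all other coefficients are multiples of q,
-- i.e. the Newton polygon of Q is the segment from (0 , r) to (k , 0). If Q = g h, then the
-- constant terms of g and h also attain s(g) and s(h), so v_p(g₀) - v_p(g_j) = r·j/k for
-- j = j(g); as gcd(k , r) = 1 this forces k ∣ j, so j = 0 or j = k, and then g or h has degree 0.

open import Defs
open import Data.Nat as ℕ using (ℕ; zero; suc; _^_; _≤_; _<_; z≤n; s≤s; NonZero)
import Data.Nat.Properties as ℕP
open import Data.Nat.Divisibility as ℕD using (_∣_; divides; _∣?_)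
open import Data.Nat.Primality using (Prime; euclidsLemma; prime⇒nonZero; prime⇒nonTrivial)
open import Data.Nat.Induction using (<-rec)
open import Data.Nat.GCD using (gcd)
open import Data.Nat.Coprimality using (Coprime; gcd≡1⇒coprime; coprime-divisor)
open import Data.Integer as ℤ using (ℤ; +_; -[1+_]; 0ℤ; 1ℤ)
import Data.Integer.Properties as ℤP
import Data.Integer.Divisibility.Signed as ℤD
open import Data.Integer.Tactic.RingSolver using (solve-∀)
open import Data.Rational as ℚ using (ℚ; mkℚ; 0ℚ; 1ℚ; _+_; _*_; -_; 1/_; _≟_; toℚᵘ)
import Data.Rational.Properties as ℚP
open import Data.Rational.Unnormalised as ℚᵘ using (mkℚᵘ; *≡*)
import Data.Rational.Unnormalised.Properties as ℚᵘP
open import Data.List using (List; []; _∷_; map; foldr; upTo; _++_)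
import Data.List.Properties as ListP
open import Data.List.Relation.Unary.All as All using (All; []; _∷_)
import Data.List.Relation.Unary.All.Properties as AllP
open import Data.Product using (∃; ∃₂; ∃-syntax; _×_; _,_; proj₁; proj₂)
open import Data.Sum as ⊎ using (_⊎_; inj₁; inj₂; [_,_]′)
open import Data.Empty using (⊥-elim)
open import Function using (_∘_)
open import Relation.Nullary using (¬_; yes; no)
open import Relation.Binary.PropositionalEquality
open import Relation.Binary.Definitions using (tri<; tri≈; tri>)
import Algebra.Properties.CommutativeSemigroup ℕP.*-commutativeSemigroup as ℕ*

x*y≢0 : ∀ {x y} → x ≢ 0ℚ → y ≢ 0ℚ → x * y ≢ 0ℚ
x*y≢0 {x} {y} x≢0 y≢0 xy≡0 = y≢0 (begin
  y                ≡⟨ sym (ℚP.*-identityˡ y) ⟩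
  1ℚ * y           ≡⟨ cong (_* y) (sym (ℚP.*-inverseˡ x)) ⟩
  (1/ x) * x * y   ≡⟨ ℚP.*-assoc (1/ x) x y ⟩
  (1/ x) * (x * y) ≡⟨ cong ((1/ x) *_) xy≡0 ⟩
  (1/ x) * 0ℚ      ≡⟨ ℚP.*-zeroʳ (1/ x) ⟩
  0ℚ               ∎)
  where
  open ≡-Reasoning
  instance _ = ℚ.≢-nonZero x≢0

-x≢0 : ∀ {x} → x ≢ 0ℚ → - x ≢ 0ℚ
-x≢0 x≢0 -x≡0 = x≢0 (ℚP.neg-injective -x≡0)

x+y-y≡x : ∀ x y → x + y + - y ≡ x
x+y-y≡x x y = trans (ℚP.+-assoc x y (- y)) (trans (cong (λ z → x + z) (ℚP.+-inverseʳ y)) (ℚP.+-identityʳ x))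

ℕtoℚ≢0 : ∀ {m} → m ≢ 0 → ℕtoℚ m ≢ 0ℚ
ℕtoℚ≢0 {m} m≢0 m≡0 with ℚᵘP.≃-trans (ℚᵘP.≃-sym (ℚP.toℚᵘ-fromℚᵘ (mkℚᵘ (+ m) 0))) (ℚᵘP.≃-reflexive (cong toℚᵘ m≡0))
... | *≡* eq = m≢0 (ℤP.+-injective (trans (sym (ℤP.*-identityʳ (+ m))) eq))

a+b≡c+d⇒a-d≡c-b : ∀ a b c d → a ℤ.+ b ≡ c ℤ.+ d → a ℤ.- d ≡ c ℤ.- b
a+b≡c+d⇒a-d≡c-b a b c d eq = begin
  a ℤ.- d                 ≡⟨ a-d≡[a+b]-[b+d] a b d ⟩
  (a ℤ.+ b) ℤ.- (b ℤ.+ d) ≡⟨ cong (ℤ._- (b ℤ.+ d)) eq ⟩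
  (c ℤ.+ d) ℤ.- (b ℤ.+ d) ≡⟨ [c+d]-[b+d]≡c-b c d b ⟩
  c ℤ.- b                 ∎
  where
  open ≡-Reasoning
  a-d≡[a+b]-[b+d] : ∀ a b d → a ℤ.- d ≡ (a ℤ.+ b) ℤ.- (b ℤ.+ d)
  a-d≡[a+b]-[b+d] = solve-∀
  [c+d]-[b+d]≡c-b : ∀ c d b → (c ℤ.+ d) ℤ.- (b ℤ.+ d) ≡ c ℤ.- b
  [c+d]-[b+d]≡c-b = solve-∀

a+e≤w⇒a-d≤w-[d+e] : ∀ a e w d → a ℤ.+ e ℤ.≤ w → a ℤ.- d ℤ.≤ w ℤ.- (d ℤ.+ e)
a+e≤w⇒a-d≤w-[d+e] a e w d le =
  subst (ℤ._≤ w ℤ.- (d ℤ.+ e)) ([a+e]-[d+e]≡a-d a e d) (ℤP.+-monoˡ-≤ (ℤ.- (d ℤ.+ e)) le)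
  where
  [a+e]-[d+e]≡a-d : ∀ a e d → (a ℤ.+ e) ℤ.- (d ℤ.+ e) ≡ a ℤ.- d
  [a+e]-[d+e]≡a-d = solve-∀

+-cancelˡ-≤ : ∀ s {a b} → s ℤ.+ a ℤ.≤ s ℤ.+ b → a ℤ.≤ b
+-cancelˡ-≤ s {a} {b} ≤ = subst₂ ℤ._≤_ (-s+[s+a]≡a s a) (-s+[s+a]≡a s b) (ℤP.+-monoʳ-≤ (ℤ.- s) ≤)
  where
  -s+[s+a]≡a : ∀ s a → ℤ.- s ℤ.+ (s ℤ.+ a) ≡ a
  -s+[s+a]≡a = solve-∀

≤∧≤∧+≡⇒≡ : ∀ {x y u w} → u ℤ.≤ x → w ℤ.≤ y → x ℤ.+ y ≡ u ℤ.+ w → x ≡ u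
≤∧≤∧+≡⇒≡ {x} {y} {u} {w} u≤x w≤y x+y≡u+w = ℤP.≤-antisym x≤u u≤x
  where
  x≤u : x ℤ.≤ u
  x≤u = +-cancelˡ-≤ y (subst₂ ℤ._≤_ (trans (sym x+y≡u+w) (ℤP.+-comm x y)) (ℤP.+-comm u y)
                                    (ℤP.+-monoʳ-≤ u w≤y))

+k*z≡+m⇒k∣m : ∀ k z m → + k ℤ.* z ≡ + m → k ∣ m
+k*z≡+m⇒k∣m k z m eq = divides ℤ.∣ z ∣ (begin
  m                      ≡⟨ cong ℤ.∣_∣ (sym eq) ⟩
  ℤ.∣ + k ℤ.* z ∣        ≡⟨ ℤP.abs-* (+ k) z ⟩
  k ℕ.* ℤ.∣ z ∣          ≡⟨ ℕP.*-comm k _ ⟩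
  ℤ.∣ z ∣ ℕ.* k          ∎)
  where open ≡-Reasoning

∣∧≤⇒≡0⊎≡ : ∀ {k i} → k ∣ i → i ≤ k → i ≡ 0 ⊎ i ≡ k
∣∧≤⇒≡0⊎≡         (divides zero    i≡0)   _   = inj₁ i≡0
∣∧≤⇒≡0⊎≡ {k} {i} (divides (suc m) i≡[1+m]*k) i≤k =
  inj₂ (ℕP.≤-antisym i≤k (subst (k ≤_) (sym i≡[1+m]*k) (ℕP.m≤m+n k (m ℕ.* k))))

coeff-addP : ∀ f g i → coeff (addP f g) i ≡ coeff f i + coeff g i
coeff-addP []      g       i       = sym (ℚP.+-identityˡ _)
coeff-addP (a ∷ f) []      i       = sym (ℚP.+-identityʳ _)
coeff-addP (a ∷ f) (b ∷ g) zero    = refl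
coeff-addP (a ∷ f) (b ∷ g) (suc i) = coeff-addP f g i

coeff-scaleP : ∀ c f i → coeff (scaleP c f) i ≡ c * coeff f i
coeff-scaleP c []      i       = sym (ℚP.*-zeroʳ c)
coeff-scaleP c (a ∷ f) zero    = refl
coeff-scaleP c (a ∷ f) (suc i) = coeff-scaleP c f i

coeff-negP : ∀ f i → coeff (negP f) i ≡ - coeff f i
coeff-negP []      i       = refl
coeff-negP (a ∷ f) zero    = refl
coeff-negP (a ∷ f) (suc i) = coeff-negP f i

coeff-subP : ∀ f g i → coeff (subP f g) i ≡ coeff f i + - coeff g i
coeff-subP f g i = trans (coeff-addP f (negP g) i) (cong (λ z → coeff f i + z) (coeff-negP g i))

coeff-mulP-zero : ∀ g h → coeff (mulP g h) 0 ≡ coeff g 0 * coeff h 0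
coeff-mulP-zero []      h = sym (ℚP.*-zeroˡ (coeff h 0))
coeff-mulP-zero (a ∷ g) h =
  trans (coeff-addP (scaleP a h) (0ℚ ∷ mulP g h) 0) (trans (ℚP.+-identityʳ _) (coeff-scaleP a h 0))

coeff-mulP-constant : ∀ g b i → coeff (mulP g (b ∷ [])) i ≡ coeff g i * b
coeff-mulP-constant []      b i       = sym (ℚP.*-zeroˡ b)
coeff-mulP-constant (a ∷ g) b zero    = ℚP.+-identityʳ _
coeff-mulP-constant (a ∷ g) b (suc i) = coeff-mulP-constant g b i

coeff-monomial-≡ : ∀ c n → coeff (monomial c n) n ≡ c
coeff-monomial-≡ c zero    = refl
coeff-monomial-≡ c (suc n) = coeff-monomial-≡ c n

coeff-monomial-≢ : ∀ c n {i} → i ≢ n → coeff (monomial c n) i ≡ 0ℚ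
coeff-monomial-≢ c zero    {zero}  i≢n = ⊥-elim (i≢n refl)
coeff-monomial-≢ c zero    {suc i} i≢n = refl
coeff-monomial-≢ c (suc n) {zero}  i≢n = refl
coeff-monomial-≢ c (suc n) {suc i} i≢n = coeff-monomial-≢ c n (λ i≡n → i≢n (cong suc i≡n))

coeff-sum-monomials-∉ : ∀ (c : ℕ → ℚ) (d : ℕ → ℕ) {i} B L → All (λ l → d l ≢ i) L →
                        coeff (foldr addP B (map (λ l → monomial (c l) (d l)) L)) i ≡ coeff B i
coeff-sum-monomials-∉ c d B []       []              = refl
coeff-sum-monomials-∉ c d {i} B (l ∷ L) (dl≢i ∷ L∌i) = begin
  coeff (addP (monomial (c l) (d l)) (foldr addP B (map _ L))) i
    ≡⟨ coeff-addP (monomial (c l) (d l)) _ i ⟩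
  coeff (monomial (c l) (d l)) i + coeff (foldr addP B (map _ L)) i
    ≡⟨ cong₂ _+_ (coeff-monomial-≢ (c l) (d l) (λ i≡dl → dl≢i (sym i≡dl))) (coeff-sum-monomials-∉ c d B L L∌i) ⟩
  0ℚ + coeff B i
    ≡⟨ ℚP.+-identityˡ _ ⟩
  coeff B i ∎
  where open ≡-Reasoning

record Valuation : Set where
  field
    v     : ℚ → ℤ
    v-*   : ∀ x y → x ≢ 0ℚ → y ≢ 0ℚ → v (x * y) ≡ v x ℤ.+ v y
    v-neg : ∀ x → v (- x) ≡ v x
    v-+   : ∀ x y → x ≢ 0ℚ → y ≢ 0ℚ → x + y ≢ 0ℚ → v x ℤ.≤ v (x + y) ⊎ v y ℤ.≤ v (x + y)

  infix 4 _≥ᵥ_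

  -- v x ≥ u, reading v 0 as +∞.
  _≥ᵥ_ : ℚ → ℤ → Set
  x ≥ᵥ u = x ≡ 0ℚ ⊎ (x ≢ 0ℚ × u ℤ.≤ v x)

  ≥ᵥ⇒≤v : ∀ {x u} → x ≥ᵥ u → x ≢ 0ℚ → u ℤ.≤ v x
  ≥ᵥ⇒≤v (inj₁ x≡0)     x≢0 = ⊥-elim (x≢0 x≡0)
  ≥ᵥ⇒≤v (inj₂ (_ , u≤)) _   = u≤

  ≥ᵥ-exact : ∀ {x} → x ≢ 0ℚ → x ≥ᵥ v x
  ≥ᵥ-exact x≢0 = inj₂ (x≢0 , ℤP.≤-refl)

  ≥ᵥ-weaken : ∀ {x u w} → u ℤ.≤ w → x ≥ᵥ w → x ≥ᵥ u
  ≥ᵥ-weaken u≤w (inj₁ x≡0)       = inj₁ x≡0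
  ≥ᵥ-weaken u≤w (inj₂ (x≢0 , w≤)) = inj₂ (x≢0 , ℤP.≤-trans u≤w w≤)

  ≥ᵥ-+ : ∀ {x y u} → x ≥ᵥ u → y ≥ᵥ u → x + y ≥ᵥ u
  ≥ᵥ-+ {x} {y} (inj₁ refl) y≥ = subst (_≥ᵥ _) (sym (ℚP.+-identityˡ y)) y≥
  ≥ᵥ-+ {x} {y} (inj₂ x≥) (inj₁ refl) = subst (_≥ᵥ _) (sym (ℚP.+-identityʳ x)) (inj₂ x≥)
  ≥ᵥ-+ {x} {y} (inj₂ (x≢0 , u≤vx)) (inj₂ (y≢0 , u≤vy)) with x + y ≟ 0ℚ
  ... | yes x+y≡0 = inj₁ x+y≡0
  ... | no x+y≢0 = inj₂ (x+y≢0 , [ ℤP.≤-trans u≤vx , ℤP.≤-trans u≤vy ]′ (v-+ x y x≢0 y≢0 x+y≢0))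

  ≥ᵥ-* : ∀ {x y u w} → x ≥ᵥ u → y ≥ᵥ w → x * y ≥ᵥ u ℤ.+ w
  ≥ᵥ-* {x} {y} (inj₁ refl) _ = inj₁ (ℚP.*-zeroˡ y)
  ≥ᵥ-* {x} {y} (inj₂ _) (inj₁ refl) = inj₁ (ℚP.*-zeroʳ x)
  ≥ᵥ-* {x} {y} (inj₂ (x≢0 , u≤)) (inj₂ (y≢0 , w≤)) =
    inj₂ (x*y≢0 x≢0 y≢0 , subst (_ ℤ.≤_) (sym (v-* x y x≢0 y≢0)) (ℤP.+-mono-≤ u≤ w≤))

  coeff-monomial-≥ᵥ : ∀ {c u} n i → c ≥ᵥ u → coeff (monomial c n) i ≥ᵥ u
  coeff-monomial-≥ᵥ n i c≥ with i ℕ.≟ n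
  ... | yes refl = subst (_≥ᵥ _) (sym (coeff-monomial-≡ _ n)) c≥
  ... | no i≢n   = inj₁ (coeff-monomial-≢ _ n i≢n)

  coeff-sum-monomials-≥ᵥ : ∀ (c : ℕ → ℚ) (d : ℕ → ℕ) {u} → (∀ l → c l ≥ᵥ u) →
                           ∀ L i → coeff (foldr addP [] (map (λ l → monomial (c l) (d l)) L)) i ≥ᵥ u
  coeff-sum-monomials-≥ᵥ c d c≥ []      i = inj₁ refl
  coeff-sum-monomials-≥ᵥ c d c≥ (l ∷ L) i =
    subst (_≥ᵥ _) (sym (coeff-addP (monomial (c l) (d l)) _ i))
          (≥ᵥ-+ (coeff-monomial-≥ᵥ (d l) i (c≥ l)) (coeff-sum-monomials-≥ᵥ c d c≥ L i))

  ≥ᵥ-neg : ∀ {x u} → x ≥ᵥ u → - x ≥ᵥ u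
  ≥ᵥ-neg (inj₁ refl) = inj₁ refl
  ≥ᵥ-neg {x} (inj₂ (x≢0 , u≤)) = inj₂ (-x≢0 x≢0 , subst (_ ℤ.≤_) (sym (v-neg x)) u≤)

  v-+-exact : ∀ {x y u} → x ≢ 0ℚ → v x ≡ u → y ≥ᵥ u ℤ.+ 1ℤ → x + y ≢ 0ℚ × v (x + y) ≡ u
  v-+-exact {x} {y} {u} x≢0 vx≡u (inj₁ refl) =
    subst (λ z → z ≢ 0ℚ × v z ≡ u) (sym (ℚP.+-identityʳ x)) (x≢0 , vx≡u)
  v-+-exact {x} {y} {u} x≢0 vx≡u (inj₂ (y≢0 , u<vy)) = x+y≢0 , ℤP.≤-antisym upper lower
    where
    vx<vy : v x ℤ.< v y
    vx<vy = subst (ℤ._< v y) (sym vx≡u) (ℤP.suc[i]≤j⇒i<j (subst (ℤ._≤ v y) (ℤP.+-comm u 1ℤ) u<vy))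
    x+y≢0 : x + y ≢ 0ℚ
    x+y≢0 x+y≡0 = ℤP.<-irrefl (sym (trans (sym (v-neg y)) (cong v -y≡x))) vx<vy
      where
      -y≡x : - y ≡ x
      -y≡x = trans (sym (ℚP.+-identityˡ (- y))) (trans (cong (_+ - y) (sym x+y≡0)) (x+y-y≡x x y))
    lower : u ℤ.≤ v (x + y)
    lower = subst (ℤ._≤ _) vx≡u
      (≥ᵥ⇒≤v (≥ᵥ-+ (≥ᵥ-exact x≢0) (inj₂ (y≢0 , ℤP.<⇒≤ vx<vy))) x+y≢0)
    upper : v (x + y) ℤ.≤ u
    upper with v-+ (x + y) (- y) x+y≢0 (-x≢0 y≢0) (subst (_≢ 0ℚ) (sym (x+y-y≡x x y)) x≢0)
    ... | inj₁ ≤vx = subst (v (x + y) ℤ.≤_) (trans (cong v (x+y-y≡x x y)) vx≡u) ≤vx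
    ... | inj₂ v-y≤ = ⊥-elim (ℤP.<⇒≱ vx<vy
      (subst₂ ℤ._≤_ (v-neg y) (cong v (x+y-y≡x x y)) v-y≤))

trivialValuation : Valuation
trivialValuation = record
  { v     = λ _ → 0ℤ
  ; v-*   = λ _ _ _ _ → refl
  ; v-neg = λ _ → refl
  ; v-+   = λ _ _ _ _ _ → inj₁ ℤP.≤-refl
  }

scaleValuation : ℕ → Valuation → Valuation
scaleValuation k V = record
  { v     = λ x → + k ℤ.* v x
  ; v-*   = λ x y x≢0 y≢0 → trans (cong (+ k ℤ.*_) (v-* x y x≢0 y≢0)) (ℤP.*-distribˡ-+ (+ k) (v x) (v y))
  ; v-neg = λ x → cong (+ k ℤ.*_) (v-neg x)
  ; v-+   = λ x y x≢0 y≢0 x+y≢0 → ⊎.map (ℤP.*-monoˡ-≤-nonNeg (+ k)) (ℤP.*-monoˡ-≤-nonNeg (+ k))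
                                                (v-+ x y x≢0 y≢0 x+y≢0)
  }
  where open Valuation V

module Newton (V : Valuation) (c : ℤ) where
  open Valuation V public

  private
    s-c*0≡s : ∀ s c → s ℤ.- c ℤ.* 0ℤ ≡ s
    s-c*0≡s = solve-∀
    [s-c*0]-[s-c*j]≡c*j : ∀ s c j → (s ℤ.- c ℤ.* 0ℤ) ℤ.- (s ℤ.- c ℤ.* j) ≡ c ℤ.* j
    [s-c*0]-[s-c*j]≡c*j = solve-∀
    s-c*[1+i]≡[s-c]-c*i : ∀ s c i → s ℤ.- c ℤ.* (1ℤ ℤ.+ i) ≡ (s ℤ.- c) ℤ.- c ℤ.* i
    s-c*[1+i]≡[s-c]-c*i = solve-∀
    [s+t]-c*i≡s+[t-c*i] : ∀ s t c i → (s ℤ.+ t) ℤ.- c ℤ.* i ≡ s ℤ.+ (t ℤ.- c ℤ.* i)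
    [s+t]-c*i≡s+[t-c*i] = solve-∀
    s-c*i+1≡[s+1]-c*i : ∀ s c i → s ℤ.- c ℤ.* i ℤ.+ 1ℤ ≡ (s ℤ.+ 1ℤ) ℤ.- c ℤ.* i
    s-c*i+1≡[s+1]-c*i = solve-∀
    s-c*i+c*i≡s : ∀ s c i → (s ℤ.- c ℤ.* i) ℤ.+ c ℤ.* i ≡ s
    s-c*i+c*i≡s = solve-∀
    [s-c]+t≡[s+t]-c : ∀ s t c → (s ℤ.- c) ℤ.+ t ≡ (s ℤ.+ t) ℤ.- c
    [s-c]+t≡[s+t]-c = solve-∀
    [s+c]-c*[1+i]≡s-c*i : ∀ s c i → (s ℤ.+ c) ℤ.- c ℤ.* (1ℤ ℤ.+ i) ≡ s ℤ.- c ℤ.* i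
    [s+c]-c*[1+i]≡s-c*i = solve-∀
    s-c*[1+i]+1≡[s+1-c]-c*i : ∀ s c i → s ℤ.- c ℤ.* (1ℤ ℤ.+ i) ℤ.+ 1ℤ ≡ (s ℤ.+ 1ℤ ℤ.- c) ℤ.- c ℤ.* i
    s-c*[1+i]+1≡[s+1-c]-c*i = solve-∀
    [s+1-c]+t≡[s+t]+1-c : ∀ s t c → (s ℤ.+ 1ℤ ℤ.- c) ℤ.+ t ≡ (s ℤ.+ t) ℤ.+ 1ℤ ℤ.- c
    [s+1-c]+t≡[s+t]+1-c = solve-∀

  -[c]+ : ∀ s t → (s ℤ.- c) ℤ.+ t ≡ (s ℤ.+ t) ℤ.- c
  -[c]+ s t = [s-c]+t≡[s+t]-c s t c

  +1-[c]+ : ∀ s t → (s ℤ.+ 1ℤ ℤ.- c) ℤ.+ t ≡ (s ℤ.+ t) ℤ.+ 1ℤ ℤ.- c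
  +1-[c]+ s t = [s+1-c]+t≡[s+t]+1-c s t c

  -- Opaque, so that s and i can be inferred from line s i.
  opaque
    line : ℤ → ℕ → ℤ
    line s i = s ℤ.- c ℤ.* + i

    line-definition : ∀ s i → line s i ≡ s ℤ.- c ℤ.* + i
    line-definition s i = refl

    line-zero : ∀ s → line s 0 ≡ s
    line-zero s = s-c*0≡s s c

    line-suc : ∀ s i → line s (suc i) ≡ line (s ℤ.- c) i
    line-suc s i = s-c*[1+i]≡[s-c]-c*i s c (+ i)

    line-+ : ∀ s t i → line (s ℤ.+ t) i ≡ s ℤ.+ line t i
    line-+ s t i = [s+t]-c*i≡s+[t-c*i] s t c (+ i)

    line-+1 : ∀ s i → line s i ℤ.+ 1ℤ ≡ line (s ℤ.+ 1ℤ) i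
    line-+1 s i = s-c*i+1≡[s+1]-c*i s c (+ i)

    line-suc-+1 : ∀ s i → line s (suc i) ℤ.+ 1ℤ ≡ line (s ℤ.+ 1ℤ ℤ.- c) i
    line-suc-+1 s i = s-c*[1+i]+1≡[s+1-c]-c*i s c (+ i)

    line-+c : ∀ s i → line (s ℤ.+ c) (suc i) ≡ line s i
    line-+c s i = [s+c]-c*[1+i]≡s-c*i s c (+ i)

    line-zero-gap : ∀ s j → line s 0 ℤ.- line s j ≡ c ℤ.* + j
    line-zero-gap s j = [s-c*0]-[s-c*j]≡c*j s c (+ j)

    line-mono : ∀ {s s′} i → s ℤ.≤ s′ → line s i ℤ.≤ line s′ i
    line-mono i s≤s′ = ℤP.+-monoˡ-≤ _ s≤s′

    line-cancel : ∀ {s s′} i → line s i ℤ.≤ line s′ i → s ℤ.≤ s′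
    line-cancel {s} {s′} i ≤ =
      subst₂ ℤ._≤_ (s-c*i+c*i≡s s c (+ i)) (s-c*i+c*i≡s s′ c (+ i)) (ℤP.+-monoˡ-≤ (c ℤ.* + i) ≤)

  -- LastContact g s j: s is the least value of v gᵢ + c·i and j the largest index attaining it.
  Above : Poly → ℤ → Set
  Above g s = ∀ i → coeff g i ≥ᵥ line s i

  StrictlyAbove : Poly → ℤ → Set
  StrictlyAbove g s = ∀ i → coeff g i ≥ᵥ line s i ℤ.+ 1ℤ

  StrictlyAboveAfter : Poly → ℤ → ℕ → Set
  StrictlyAboveAfter g s j = ∀ i → j < i → coeff g i ≥ᵥ line s i ℤ.+ 1ℤ

  record LastContact (g : Poly) (s : ℤ) (j : ℕ) : Set where
    field
      above          : Above g s
      contact≢0      : coeff g j ≢ 0ℚ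
      contact        : v (coeff g j) ≡ line s j
      strictly-after : StrictlyAboveAfter g s j
  open LastContact public

  above-addP : ∀ {f g s} → Above f s → Above g s → Above (addP f g) s
  above-addP {f} {g} f≥ g≥ i = subst (_≥ᵥ _) (sym (coeff-addP f g i)) (≥ᵥ-+ (f≥ i) (g≥ i))

  above-tail : ∀ {a g s} → Above (a ∷ g) s → Above g (s ℤ.- c)
  above-tail {s = s} ≥ i = subst (_ ≥ᵥ_) (line-suc s i) (≥ (suc i))

  above-0∷ : ∀ {g s} → Above g (s ℤ.- c) → Above (0ℚ ∷ g) s
  above-0∷         ≥ zero    = inj₁ refl
  above-0∷ {s = s} ≥ (suc i) = subst (_ ≥ᵥ_) (sym (line-suc s i)) (≥ i)

  above-scaleP : ∀ {a h s t} → a ≥ᵥ s → Above h t → Above (scaleP a h) (s ℤ.+ t)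
  above-scaleP {a} {h} {s} {t} a≥ h≥ i =
    subst₂ _≥ᵥ_ (sym (coeff-scaleP a h i)) (sym (line-+ s t i)) (≥ᵥ-* a≥ (h≥ i))

  above-mulP : ∀ {g h s t} → Above g s → Above h t → Above (mulP g h) (s ℤ.+ t)
  above-mulP {[]}    _ _ i = inj₁ refl
  above-mulP {a ∷ g} {h} {s} {t} g≥ h≥ = above-addP {scaleP a h} {0ℚ ∷ mulP g h}
    (above-scaleP {a} {h} (subst (a ≥ᵥ_) (line-zero s) (g≥ 0)) h≥)
    (above-0∷ {mulP g h} (subst (Above (mulP g h)) (-[c]+ s t) (above-mulP {g} {h} (above-tail {a} {g} g≥) h≥)))

  strictlyAbove⇒above : ∀ {g s} → StrictlyAbove g s → Above g s
  strictlyAbove⇒above g> i = ≥ᵥ-weaken (ℤP.i≤i+j _ 1ℤ) (g> i)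

  0∷-strictlyAbove : ∀ {g s} → Above g (s ℤ.+ 1ℤ ℤ.- c) → StrictlyAbove (0ℚ ∷ g) s
  0∷-strictlyAbove         g≥ zero    = inj₁ refl
  0∷-strictlyAbove {s = s} g≥ (suc i) = subst (_ ≥ᵥ_) (sym (line-suc-+1 s i)) (g≥ i)

  strictlyAboveAfter-scaleP : ∀ {a h s t l} → a ≥ᵥ s → StrictlyAboveAfter h t l →
                              StrictlyAboveAfter (scaleP a h) (s ℤ.+ t) l
  strictlyAboveAfter-scaleP {a} {h} {s} {t} a≥ h> i l<i =
    subst₂ _≥ᵥ_ (sym (coeff-scaleP a h i)) (trans (sym (ℤP.+-assoc s (line t i) 1ℤ)) (cong (ℤ._+ 1ℤ) (sym (line-+ s t i)))) (≥ᵥ-* a≥ (h> i l<i))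

  lastContact-zero : ∀ {g} → coeff g 0 ≢ 0ℚ → StrictlyAboveAfter g (v (coeff g 0)) 0 →
                     LastContact g (v (coeff g 0)) 0
  lastContact-zero {g} g₀≢0 g> = record
    { above          = λ { zero    → inj₂ (g₀≢0 , ℤP.≤-reflexive (line-zero _))
                         ; (suc i) → ≥ᵥ-weaken (ℤP.i≤i+j _ 1ℤ) (g> (suc i) (s≤s z≤n)) }
    ; contact≢0      = g₀≢0
    ; contact        = sym (line-zero _)
    ; strictly-after = g>
    }

  lastContact-top : ∀ {g s j} → Above g s → coeff g j ≢ 0ℚ → v (coeff g j) ≡ line s j →
                    (∀ i → j < i → coeff g i ≡ 0ℚ) → LastContact g s j
  lastContact-top g≥ gⱼ≢0 vgⱼ g≡0 = record
    { above          = g≥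
    ; contact≢0      = gⱼ≢0
    ; contact        = vgⱼ
    ; strictly-after = λ i j<i → inj₁ (g≡0 i j<i)
    }

  lastContact-∷ : ∀ {a g s j} → a ≥ᵥ s ℤ.+ c → LastContact g s j → LastContact (a ∷ g) (s ℤ.+ c) (suc j)
  lastContact-∷ {a} {g} {s} {j} a≥ G = record
    { above          = λ { zero    → subst (a ≥ᵥ_) (sym (line-zero (s ℤ.+ c))) a≥
                         ; (suc i) → subst (_ ≥ᵥ_) (sym (line-+c s i)) (above G i) }
    ; contact≢0      = contact≢0 G
    ; contact        = trans (contact G) (sym (line-+c s j))
    ; strictly-after = λ { (suc i) (s≤s j<i) → subst (_ ≥ᵥ_) (cong (ℤ._+ 1ℤ) (sym (line-+c s i)))
                                                       (strictly-after G i j<i) }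
    }

  lastContact-tail : ∀ {a g s j} → LastContact (a ∷ g) s (suc j) → LastContact g (s ℤ.- c) j
  lastContact-tail {a} {g} {s} {j} G = record
    { above          = above-tail {a} {g} (above G)
    ; contact≢0      = contact≢0 G
    ; contact        = trans (contact G) (line-suc s j)
    ; strictly-after = λ i j<i → subst (_ ≥ᵥ_) (cong (ℤ._+ 1ℤ) (line-suc s i)) (strictly-after G (suc i) (s≤s j<i))
    }

  lastContact-0∷ : ∀ {g s j} → LastContact g (s ℤ.- c) j → LastContact (0ℚ ∷ g) s (suc j)
  lastContact-0∷ {g} {s} {j} G = record
    { above          = above-0∷ {g} (above G)
    ; contact≢0      = contact≢0 G
    ; contact        = trans (contact G) (sym (line-suc s j))
    ; strictly-after = λ { (suc i) (s≤s j<i) → subst (_ ≥ᵥ_) (cong (ℤ._+ 1ℤ) (sym (line-suc s i)))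
                                                       (strictly-after G i j<i) }
    }

  lastContact-scaleP : ∀ {a h s t l} → a ≢ 0ℚ → v a ≡ s → LastContact h t l →
                       LastContact (scaleP a h) (s ℤ.+ t) l
  lastContact-scaleP {a} {h} {s} {t} {l} a≢0 va≡s H = record
    { above          = above-scaleP {a} {h} a≥ (above H)
    ; contact≢0      = subst (_≢ 0ℚ) (sym (coeff-scaleP a h l)) (x*y≢0 a≢0 (contact≢0 H))
    ; contact        = begin
        v (coeff (scaleP a h) l)   ≡⟨ cong v (coeff-scaleP a h l) ⟩
        v (a * coeff h l)          ≡⟨ v-* a (coeff h l) a≢0 (contact≢0 H) ⟩
        v a ℤ.+ v (coeff h l)      ≡⟨ cong₂ ℤ._+_ va≡s (contact H) ⟩
        s ℤ.+ line t l             ≡⟨ sym (line-+ s t l) ⟩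
        line (s ℤ.+ t) l           ∎
    ; strictly-after = strictlyAboveAfter-scaleP {a} {h} a≥ (strictly-after H)
    }
    where
    open ≡-Reasoning
    a≥ : a ≥ᵥ s
    a≥ = inj₂ (a≢0 , ℤP.≤-reflexive (sym va≡s))

  lastContact-+strictlyAbove : ∀ {f g s l} → LastContact f s l → StrictlyAbove g s →
                               LastContact (addP f g) s l
  lastContact-+strictlyAbove {f} {g} {s} {l} F g> = record
    { above          = above-addP {f} {g} (above F) (strictlyAbove⇒above {g} g>)
    ; contact≢0      = subst (_≢ 0ℚ) (sym (coeff-addP f g l)) (proj₁ exact)
    ; contact        = trans (cong v (coeff-addP f g l)) (proj₂ exact)
    ; strictly-after = λ i l<i → subst (_≥ᵥ _) (sym (coeff-addP f g i)) (≥ᵥ-+ (strictly-after F i l<i) (g> i))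
    }
    where exact = v-+-exact (contact≢0 F) (contact F) (g> l)

  lastContact-+ : ∀ {f g s l m} → Above f s → StrictlyAboveAfter f s l → l < m → LastContact g s m →
                  LastContact (addP f g) s m
  lastContact-+ {f} {g} {s} {l} {m} f≥ f> l<m G = record
    { above          = above-addP {f} {g} f≥ (above G)
    ; contact≢0      = subst (_≢ 0ℚ) (sym (trans (coeff-addP f g m) (ℚP.+-comm (coeff f m) (coeff g m)))) (proj₁ exact)
    ; contact        = trans (cong v (trans (coeff-addP f g m) (ℚP.+-comm (coeff f m) (coeff g m)))) (proj₂ exact)
    ; strictly-after = λ i m<i → subst (_≥ᵥ _) (sym (coeff-addP f g i))
                                   (≥ᵥ-+ (f> i (ℕP.<-trans l<m m<i)) (strictly-after G i m<i))
    }
    where exact = v-+-exact (contact≢0 G) (contact G) (f> m l<m)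

  lastContact-mulP : ∀ {g h s t j l} → LastContact g s j → LastContact h t l →
                     LastContact (mulP g h) (s ℤ.+ t) (j ℕ.+ l)
  lastContact-mulP {[]} G _ = ⊥-elim (contact≢0 G refl)
  lastContact-mulP {a ∷ g} {h} {s} {t} {zero} G H =
    lastContact-+strictlyAbove {scaleP a h} {0ℚ ∷ mulP g h}
      (lastContact-scaleP (contact≢0 G) (trans (contact G) (line-zero s)) H)
      (0∷-strictlyAbove {mulP g h} (subst (Above (mulP g h)) (+1-[c]+ s t) (above-mulP {g} {h} g≥ (above H))))
    where
    g≥ : Above g (s ℤ.+ 1ℤ ℤ.- c)
    g≥ i = subst (_ ≥ᵥ_) (line-suc-+1 s i) (strictly-after G (suc i) (s≤s z≤n))
  lastContact-mulP {a ∷ g} {h} {s} {t} {suc j} {l} G H =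
    lastContact-+ {scaleP a h} {0ℚ ∷ mulP g h}
      (above-scaleP {a} {h} a≥ (above H)) (strictlyAboveAfter-scaleP {a} {h} a≥ (strictly-after H))
      (s≤s (ℕP.m≤n+m l j))
      (lastContact-0∷ (subst (λ u → LastContact (mulP g h) u (j ℕ.+ l)) (-[c]+ s t)
                              (lastContact-mulP (lastContact-tail {a} G) H)))
    where
    a≥ : a ≥ᵥ s
    a≥ = subst (a ≥ᵥ_) (line-zero s) (above G 0)

  lastContact? : ∀ g → (∀ i → coeff g i ≡ 0ℚ) ⊎ ∃₂ (LastContact g)
  lastContact? []      = inj₁ λ _ → refl
  lastContact? (a ∷ g) with lastContact? g | a ≟ 0ℚ
  ... | inj₁ g≡0 | yes a≡0 = inj₁ λ { zero → a≡0 ; (suc i) → g≡0 i }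
  ... | inj₁ g≡0 | no a≢0  = inj₂ (_ , _ , lastContact-zero {a ∷ g} a≢0 λ { (suc i) _ → inj₁ (g≡0 i) })
  ... | inj₂ (s , j , G) | yes a≡0 = inj₂ (_ , _ , lastContact-∷ (inj₁ a≡0) G)
  ... | inj₂ (s , j , G) | no a≢0 with s ℤ.+ c ℤ.≤? v a
  ...   | yes s+c≤va = inj₂ (_ , _ , lastContact-∷ (inj₂ (a≢0 , s+c≤va)) G)
  ...   | no s+c≰va  = inj₂ (_ , _ , lastContact-zero {a ∷ g} a≢0 λ { (suc i) _ → ≥ᵥ-weaken (below i) (above G i) })
    where
    va+1≤s+c : v a ℤ.+ 1ℤ ℤ.≤ s ℤ.+ c
    va+1≤s+c = subst (ℤ._≤ _) (ℤP.+-comm 1ℤ (v a)) (ℤP.i<j⇒suc[i]≤j (ℤP.≰⇒> s+c≰va))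
    below : ∀ i → line (v a) (suc i) ℤ.+ 1ℤ ℤ.≤ line s i
    below i = subst₂ ℤ._≤_ (sym (line-+1 (v a) (suc i))) (line-+c s i) (line-mono (suc i) va+1≤s+c)

  lastContact-exists : ∀ {g i} → coeff g i ≢ 0ℚ → ∃₂ (LastContact g)
  lastContact-exists {g} {i} gᵢ≢0 with lastContact? g
  ... | inj₁ g≡0 = ⊥-elim (gᵢ≢0 (g≡0 i))
  ... | inj₂ G   = G

  private
    s+1≰s : ∀ s → ¬ (s ℤ.+ 1ℤ ℤ.≤ s)
    s+1≰s s s+1≤s = ℤP.<-irrefl refl (ℤP.suc[i]≤j⇒i<j (subst (ℤ._≤ s) (ℤP.+-comm s 1ℤ) s+1≤s))

    contact-not-before : ∀ {g s s′ j j′} → LastContact g s j → LastContact g s′ j′ → ¬ j < j′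
    contact-not-before {g} {s} {s′} {j} {j′} G G′ j<j′ = s+1≰s s (ℤP.≤-trans s+1≤s′ s′≤s)
      where
      s+1≤s′ : s ℤ.+ 1ℤ ℤ.≤ s′
      s+1≤s′ = line-cancel j′ (subst₂ ℤ._≤_ (line-+1 s j′) (contact G′)
                                 (≥ᵥ⇒≤v (strictly-after G j′ j<j′) (contact≢0 G′)))
      s′≤s : s′ ℤ.≤ s
      s′≤s = line-cancel j (subst (line s′ j ℤ.≤_) (contact G) (≥ᵥ⇒≤v (above G′ j) (contact≢0 G)))

  lastContact-unique : ∀ {g s s′ j j′} → LastContact g s j → LastContact g s′ j′ → j ≡ j′ × s ≡ s′
  lastContact-unique {j = j} {j′} G G′ with ℕP.<-cmp j j′
  ... | tri< j<j′ _ _ = ⊥-elim (contact-not-before G G′ j<j′)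
  ... | tri> _ _ j′<j = ⊥-elim (contact-not-before G′ G j′<j)
  ... | tri≈ _ refl _ = refl , ℤP.≤-antisym (same-height G G′) (same-height G′ G)
    where
    same-height : ∀ {g s s′} → LastContact g s j → LastContact g s′ j → s ℤ.≤ s′
    same-height G G′ = line-cancel j (ℤP.≤-reflexive (trans (sym (contact G)) (contact G′)))

  lastContact-≈ₚ : ∀ {g h s j} → g ≈ₚ h → LastContact g s j → LastContact h s j
  lastContact-≈ₚ {g} {h} {s} {j} g≈h G = record
    { above          = λ i → subst (_≥ᵥ _) (g≈h i) (above G i)
    ; contact≢0      = subst (_≢ 0ℚ) (g≈h j) (contact≢0 G)
    ; contact        = trans (cong v (sym (g≈h j))) (contact G)
    ; strictly-after = λ i j<i → subst (_≥ᵥ _) (g≈h i) (strictly-after G i j<i)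
    }

  constant-contact-factor : ∀ {g h s t j l} → LastContact g s j → LastContact h t l →
                            coeff g 0 ≢ 0ℚ → coeff h 0 ≢ 0ℚ → v (coeff g 0 * coeff h 0) ≡ s ℤ.+ t →
                            v (coeff g 0) ≡ s
  constant-contact-factor {g} {h} {s} {t} G H g₀≢0 h₀≢0 vg₀h₀ = ≤∧≤∧+≡⇒≡
    (subst (ℤ._≤ _) (line-zero s) (≥ᵥ⇒≤v (above G 0) g₀≢0))
    (subst (ℤ._≤ _) (line-zero t) (≥ᵥ⇒≤v (above H 0) h₀≢0))
    (trans (sym (v-* (coeff g 0) (coeff h 0) g₀≢0 h₀≢0)) vg₀h₀)

  lastContact>0⇒¬unit : ∀ {g s j} → 0 < j → LastContact g s j → ¬ IsUnit g
  lastContact>0⇒¬unit {g} {j = suc _} _ G (u , gu≈1) with lastContact? u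
  ... | inj₁ u≡0 = ℚP.1≢0 (begin
    1ℚ                   ≡⟨ sym (gu≈1 0) ⟩
    coeff (mulP g u) 0   ≡⟨ coeff-mulP-zero g u ⟩
    coeff g 0 * coeff u 0 ≡⟨ cong (coeff g 0 *_) (u≡0 0) ⟩
    coeff g 0 * 0ℚ       ≡⟨ ℚP.*-zeroʳ (coeff g 0) ⟩
    0ℚ                   ∎)
    where open ≡-Reasoning
  ... | inj₂ (_ , _ , U) = contact≢0 (lastContact-≈ₚ {mulP g u} {oneP} gu≈1 (lastContact-mulP G U)) refl

-- With the trivial valuation and slope -1, LastContact g s j says that j is the degree of g.
module Degree where
  open Newton trivialValuation (ℤ.- 1ℤ) public

  line≡s+i : ∀ s i → line s i ≡ s ℤ.+ + i
  line≡s+i s i = trans (line-definition s i) (s-[-1]*i≡s+i s (+ i))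
    where
    s-[-1]*i≡s+i : ∀ s i → s ℤ.- (ℤ.- 1ℤ) ℤ.* i ≡ s ℤ.+ i
    s-[-1]*i≡s+i = solve-∀

  lastContact-degree : ∀ {g n} → coeff g n ≢ 0ℚ → (∀ i → n < i → coeff g i ≡ 0ℚ) →
                       LastContact g (ℤ.- + n) n
  lastContact-degree {g} {n} gₙ≢0 g≡0 =
    lastContact-top above-line gₙ≢0 (sym (trans (line≡s+i _ n) (ℤP.+-inverseˡ (+ n)))) g≡0
    where
    above-line : Above g (ℤ.- + n)
    above-line i with coeff g i ≟ 0ℚ | i ℕ.≤? n
    ... | yes gᵢ≡0 | _      = inj₁ gᵢ≡0
    ... | no gᵢ≢0 | yes i≤n = inj₂ (gᵢ≢0 , subst₂ ℤ._≤_ (sym (line≡s+i _ i)) (ℤP.+-inverseˡ (+ n))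
                                              (ℤP.+-monoʳ-≤ (ℤ.- + n) (ℤ.+≤+ i≤n)))
    ... | no gᵢ≢0 | no i≰n  = ⊥-elim (gᵢ≢0 (g≡0 i (ℕP.≰⇒> i≰n)))

  ≤degree : ∀ {g s j i} → LastContact g s j → coeff g i ≢ 0ℚ → i ≤ j
  ≤degree {g} {s} {j} {i} G gᵢ≢0 with i ℕ.≤? j
  ... | yes i≤j = i≤j
  ... | no i≰j  = ⊥-elim (ℕP.<-asym (ℤP.drop‿+≤+ (+-cancelˡ-≤ s s+[1+i]≤s+j)) j<i)
    where
    j<i : j < i
    j<i = ℕP.≰⇒> i≰j
    s+i+1≡s+[1+i] : ∀ s i → s ℤ.+ i ℤ.+ 1ℤ ≡ s ℤ.+ (1ℤ ℤ.+ i)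
    s+i+1≡s+[1+i] = solve-∀
    s+[1+i]≤s+j : s ℤ.+ + suc i ℤ.≤ s ℤ.+ + j
    s+[1+i]≤s+j = subst₂ ℤ._≤_ (trans (cong (ℤ._+ 1ℤ) (line≡s+i s i)) (s+i+1≡s+[1+i] s (+ i)))
                                (trans (contact G) (line≡s+i s j))
                                (≥ᵥ⇒≤v (strictly-after G i j<i) gᵢ≢0)

  lastContact-zero⇒unit : ∀ {g s} → LastContact g s 0 → IsUnit g
  lastContact-zero⇒unit {g} G = 1/ coeff g 0 ∷ [] , inverse
    where
    instance _ = ℚ.≢-nonZero (contact≢0 G)
    constant : ∀ i → coeff g (suc i) ≡ 0ℚ
    constant i with coeff g (suc i) ≟ 0ℚ
    ... | yes gᵢ≡0 = gᵢ≡0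
    ... | no gᵢ≢0 with ≤degree G gᵢ≢0
    ...   | ()
    inverse : mulP g (1/ coeff g 0 ∷ []) ≈ₚ oneP
    inverse zero    = trans (coeff-mulP-constant g _ 0) (ℚP.*-inverseʳ (coeff g 0))
    inverse (suc i) = trans (coeff-mulP-constant g _ (suc i))
                            (trans (cong (_* 1/ coeff g 0) (constant i)) (ℚP.*-zeroˡ (1/ coeff g 0)))

module PAdic (p : ℕ) (p-prime : Prime p) where

  instance
    p≢0 : NonZero p
    p≢0 = prime⇒nonZero p-prime

  1<p : 1 < p
  1<p = ℕ.nonTrivial⇒n>1 p {{prime⇒nonTrivial p-prime}}

  p∤1 : ¬ p ∣ 1
  p∤1 p∣1 = ℕ.nonTrivial⇒≢1 {{prime⇒nonTrivial p-prime}} (ℕD.∣1⇒≡1 p∣1)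

  p∤m*n : ∀ {m n} → ¬ p ∣ m → ¬ p ∣ n → ¬ p ∣ m ℕ.* n
  p∤m*n {m} {n} p∤m p∤n p∣mn = [ p∤m , p∤n ]′ (euclidsLemma m n p-prime p∣mn)

  Split : ℕ → ℕ → Set
  Split n e = ∃[ m ] n ≡ p ^ e ℕ.* m × ¬ p ∣ m

  split : ∀ n → n ≢ 0 → ∃ (Split n)
  split = <-rec (λ n → n ≢ 0 → ∃ (Split n)) step
    where
    step : ∀ n → (∀ {m} → m < n → m ≢ 0 → ∃ (Split m)) → n ≢ 0 → ∃ (Split n)
    step n rec n≢0 with p ∣? n
    ... | no p∤n = 0 , n , sym (ℕP.+-identityʳ n) , p∤n
    ... | yes (divides m n≡m*p) with rec m<n m≢0
      where
      m≢0 : m ≢ 0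
      m≢0 m≡0 = n≢0 (trans n≡m*p (cong (ℕ._* p) m≡0))
      m<n : m < n
      m<n = subst (m <_) (sym n≡m*p) (ℕP.m<m*n m p {{ℕ.≢-nonZero m≢0}} 1<p)
    ...   | e , u , m≡p^e*u , p∤u = suc e , u , n≡p^[1+e]*u , p∤u
      where
      n≡p^[1+e]*u : n ≡ p ^ suc e ℕ.* u
      n≡p^[1+e]*u = begin
        n                   ≡⟨ n≡m*p ⟩
        m ℕ.* p             ≡⟨ cong (ℕ._* p) m≡p^e*u ⟩
        p ^ e ℕ.* u ℕ.* p   ≡⟨ ℕ*.xy∙z≈zx∙y (p ^ e) u p ⟩
        p ℕ.* p ^ e ℕ.* u   ∎
        where open ≡-Reasoning

  opaque
    vₚ : ℕ → ℕ
    vₚ zero    = 0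
    vₚ (suc n) = proj₁ (split (suc n) λ ())

    vₚ-split : ∀ {n} → n ≢ 0 → Split n (vₚ n)
    vₚ-split {zero}  n≢0 = ⊥-elim (n≢0 refl)
    vₚ-split {suc n} _   = proj₂ (split (suc n) λ ())

  p∣p^[1+e]*m : ∀ e m → p ∣ p ^ suc e ℕ.* m
  p∣p^[1+e]*m e m = ℕD.∣-trans (ℕD.m∣m*n (p ^ e)) (ℕD.m∣m*n m)

  split-unique : ∀ {n e e′} → Split n e → Split n e′ → e ≡ e′
  split-unique {e = zero}  {zero}    _ _ = refl
  split-unique {e = zero}  {suc e′} (m , refl , p∤m) (m′ , eq , _) =
    ⊥-elim (p∤m (subst (p ∣_) (trans (sym eq) (ℕP.*-identityˡ m)) (p∣p^[1+e]*m e′ m′)))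
  split-unique {e = suc e} {zero}   (m , eq , _) (m′ , refl , p∤m′) =
    ⊥-elim (p∤m′ (subst (p ∣_) (trans (sym eq) (ℕP.*-identityˡ m′)) (p∣p^[1+e]*m e m)))
  split-unique {e = suc e} {suc e′} (m , eq , p∤m) (m′ , eq′ , p∤m′) =
    cong suc (split-unique (m , refl , p∤m) (m′ , ℕP.*-cancelˡ-≡ _ _ p lift , p∤m′))
    where
    lift : p ℕ.* (p ^ e ℕ.* m) ≡ p ℕ.* (p ^ e′ ℕ.* m′)
    lift = trans (sym (ℕP.*-assoc p (p ^ e) m)) (trans (sym eq) (trans eq′ (ℕP.*-assoc p (p ^ e′) m′)))

  vₚ-unique : ∀ {n e} → n ≢ 0 → Split n e → vₚ n ≡ e
  vₚ-unique n≢0 s = split-unique (vₚ-split n≢0) s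

  vₚ-* : ∀ a b → a ≢ 0 → b ≢ 0 → vₚ (a ℕ.* b) ≡ vₚ a ℕ.+ vₚ b
  vₚ-* a b a≢0 b≢0 with vₚ-split a≢0 | vₚ-split b≢0
  ... | m , a≡ , p∤m | m′ , b≡ , p∤m′ =
    vₚ-unique ab≢0 (m ℕ.* m′ , ab≡ , p∤m*n p∤m p∤m′)
    where
    ab≢0 : a ℕ.* b ≢ 0
    ab≢0 ab≡0 = [ a≢0 , b≢0 ]′ (ℕP.m*n≡0⇒m≡0∨n≡0 a ab≡0)
    ab≡ : a ℕ.* b ≡ p ^ (vₚ a ℕ.+ vₚ b) ℕ.* (m ℕ.* m′)
    ab≡ = begin
      a ℕ.* b                                  ≡⟨ cong₂ ℕ._*_ a≡ b≡ ⟩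
      p ^ vₚ a ℕ.* m ℕ.* (p ^ vₚ b ℕ.* m′)     ≡⟨ ℕ*.interchange (p ^ vₚ a) m (p ^ vₚ b) m′ ⟩
      p ^ vₚ a ℕ.* p ^ vₚ b ℕ.* (m ℕ.* m′)     ≡⟨ cong (ℕ._* (m ℕ.* m′)) (sym (ℕP.^-distribˡ-+-* p (vₚ a) (vₚ b))) ⟩
      p ^ (vₚ a ℕ.+ vₚ b) ℕ.* (m ℕ.* m′)       ∎
      where open ≡-Reasoning

  p^vₚ∣ : ∀ {a} → a ≢ 0 → p ^ vₚ a ∣ a
  p^vₚ∣ a≢0 with vₚ-split a≢0
  ... | m , a≡ , _ = divides m (trans a≡ (ℕP.*-comm _ m))

  p^-mono-∣ : ∀ {a b} → a ≤ b → p ^ a ∣ p ^ b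
  p^-mono-∣ {a} {b} a≤b = divides (p ^ (b ℕ.∸ a)) (begin
    p ^ b                      ≡⟨ cong (p ^_) (sym (ℕP.m∸n+n≡m a≤b)) ⟩
    p ^ (b ℕ.∸ a ℕ.+ a)        ≡⟨ ℕP.^-distribˡ-+-* p (b ℕ.∸ a) a ⟩
    p ^ (b ℕ.∸ a) ℕ.* p ^ a    ∎)
    where open ≡-Reasoning

  p^e∣⇒e≤vₚ : ∀ {a e} → a ≢ 0 → p ^ e ∣ a → e ≤ vₚ a
  p^e∣⇒e≤vₚ {a} {e} a≢0 p^e∣a with e ℕ.≤? vₚ a | vₚ-split a≢0
  ... | yes e≤v | _ = e≤v
  ... | no e≰v | m , a≡ , p∤m =
    ⊥-elim (p∤m (ℕD.*-cancelˡ-∣ (p ^ vₚ a) {{ℕP.m^n≢0 p (vₚ a)}} p^[1+v]∣p^v*m))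
    where
    p^[1+v]∣p^v*m : p ^ vₚ a ℕ.* p ∣ p ^ vₚ a ℕ.* m
    p^[1+v]∣p^v*m = subst₂ _∣_ (ℕP.*-comm p (p ^ vₚ a)) a≡ (ℕD.∣-trans (p^-mono-∣ (ℕP.≰⇒> e≰v)) p^e∣a)

  vₚ-p^ : ∀ r → vₚ (p ^ r) ≡ r
  vₚ-p^ r = vₚ-unique (ℕ.≢-nonZero⁻¹ (p ^ r) {{ℕP.m^n≢0 p r}}) (1 , sym (ℕP.*-identityʳ _) , p∤1)

  p∤⇒≢0 : ∀ {m} → ¬ p ∣ m → m ≢ 0
  p∤⇒≢0 p∤m refl = p∤m (ℕD._∣0 p)

  p∤m^ : ∀ {m} e → ¬ p ∣ m → ¬ p ∣ m ^ e
  p∤m^ zero    p∤m = p∤1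
  p∤m^ (suc e) p∤m = p∤m*n p∤m (p∤m^ e p∤m)

  vₚ-^ : ∀ {m} e → ¬ p ∣ m → vₚ (m ^ e) ≡ 0
  vₚ-^ {m} e p∤m = vₚ-unique (p∤⇒≢0 p∤m^e) (m ^ e , sym (ℕP.+-identityʳ _) , p∤m^e)
    where
    p∤m^e : ¬ p ∣ m ^ e
    p∤m^e = p∤m^ e p∤m

  vℤ : ℤ → ℕ
  vℤ i = vₚ ℤ.∣ i ∣

  ∣i∣≢0 : ∀ {i} → i ≢ 0ℤ → ℤ.∣ i ∣ ≢ 0
  ∣i∣≢0 i≢0 ∣i∣≡0 = i≢0 (ℤP.∣i∣≡0⇒i≡0 ∣i∣≡0)

  vℤ-* : ∀ i j → i ≢ 0ℤ → j ≢ 0ℤ → vℤ (i ℤ.* j) ≡ vℤ i ℕ.+ vℤ j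
  vℤ-* i j i≢0 j≢0 = trans (cong vₚ (ℤP.abs-* i j)) (vₚ-* _ _ (∣i∣≢0 i≢0) (∣i∣≢0 j≢0))

  p^e∣-+ : ∀ i j {e} → i ℤ.+ j ≢ 0ℤ → p ^ e ∣ ℤ.∣ i ∣ → p ^ e ∣ ℤ.∣ j ∣ → e ≤ vℤ (i ℤ.+ j)
  p^e∣-+ i j {e} i+j≢0 ∣i ∣j = p^e∣⇒e≤vₚ (∣i∣≢0 i+j≢0)
    (ℤD.∣⇒∣ᵤ {+ (p ^ e)} (ℤD.∣m∣n⇒∣m+n (ℤD.∣ᵤ⇒∣ {+ (p ^ e)} {i} ∣i) (ℤD.∣ᵤ⇒∣ {+ (p ^ e)} {j} ∣j)))

  vℤ-+ : ∀ i j → i ≢ 0ℤ → j ≢ 0ℤ → i ℤ.+ j ≢ 0ℤ →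
         vℤ i ≤ vℤ (i ℤ.+ j) ⊎ vℤ j ≤ vℤ (i ℤ.+ j)
  vℤ-+ i j i≢0 j≢0 i+j≢0 with ℕP.≤-total (vℤ i) (vℤ j)
  ... | inj₁ vi≤vj = inj₁ (p^e∣-+ i j i+j≢0 (p^vₚ∣ (∣i∣≢0 i≢0)) (ℕD.∣-trans (p^-mono-∣ vi≤vj) (p^vₚ∣ (∣i∣≢0 j≢0))))
  ... | inj₂ vj≤vi = inj₂ (p^e∣-+ i j i+j≢0 (ℕD.∣-trans (p^-mono-∣ vj≤vi) (p^vₚ∣ (∣i∣≢0 i≢0))) (p^vₚ∣ (∣i∣≢0 j≢0)))

  vℚ : ℚ → ℤ
  vℚ x = + vℤ (ℚ.numerator x) ℤ.- + vₚ (ℚ.denominatorℕ x)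

  numerator≢0 : ∀ {x} → x ≢ 0ℚ → ℚ.numerator x ≢ 0ℤ
  numerator≢0 {x} x≢0 n≡0 = x≢0 (ℚP.↥p≡0⇒p≡0 x n≡0)

  vℚ-≃ : ∀ x a b → x ≢ 0ℚ → a ≢ 0ℤ → toℚᵘ x ℚᵘ.≃ mkℚᵘ a b → vℚ x ≡ + vℤ a ℤ.- + vₚ (suc b)
  vℚ-≃ x@(mkℚ n d _) a b x≢0 a≢0 (*≡* n[1+b]≡a[1+d]) = a+b≡c+d⇒a-d≡c-b (+ vℤ n) (+ vₚ (suc b)) (+ vℤ a) (+ vₚ (suc d)) (begin
    + vℤ n ℤ.+ + vₚ (suc b)    ≡⟨ sym (ℤP.pos-+ (vℤ n) (vₚ (suc b))) ⟩
    + (vℤ n ℕ.+ vₚ (suc b))    ≡⟨ cong +_ (sym (vℤ-* n (+ suc b) (numerator≢0 x≢0) λ ())) ⟩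
    + vℤ (n ℤ.* + suc b)       ≡⟨ cong (λ z → + vℤ z) n[1+b]≡a[1+d] ⟩
    + vℤ (a ℤ.* + suc d)       ≡⟨ cong +_ (vℤ-* a (+ suc d) a≢0 λ ()) ⟩
    + (vℤ a ℕ.+ vₚ (suc d))    ≡⟨ ℤP.pos-+ (vℤ a) (vₚ (suc d)) ⟩
    + vℤ a ℤ.+ + vₚ (suc d)    ∎)
    where open ≡-Reasoning

  vℚ-* : ∀ x y → x ≢ 0ℚ → y ≢ 0ℚ → vℚ (x * y) ≡ vℚ x ℤ.+ vℚ y
  vℚ-* x@(mkℚ n d _) y@(mkℚ n′ d′ _) x≢0 y≢0 = begin
    vℚ (x * y)
      ≡⟨ vℚ-≃ (x * y) (n ℤ.* n′) (d′ ℕ.+ d ℕ.* suc d′) (x*y≢0 x≢0 y≢0) nn′≢0 (ℚP.toℚᵘ-homo-* x y) ⟩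
    + vℤ (n ℤ.* n′) ℤ.- + vₚ (suc d ℕ.* suc d′)
      ≡⟨ cong₂ (λ u w → + u ℤ.- + w) (vℤ-* n n′ (numerator≢0 x≢0) (numerator≢0 y≢0)) (vₚ-* (suc d) (suc d′) (λ ()) (λ ())) ⟩
    + (vℤ n ℕ.+ vℤ n′) ℤ.- + (vₚ (suc d) ℕ.+ vₚ (suc d′))
      ≡⟨ cong₂ ℤ._-_ (ℤP.pos-+ (vℤ n) _) (ℤP.pos-+ (vₚ (suc d)) _) ⟩
    (+ vℤ n ℤ.+ + vℤ n′) ℤ.- (+ vₚ (suc d) ℤ.+ + vₚ (suc d′))
      ≡⟨ regroup (+ vℤ n) (+ vℤ n′) (+ vₚ (suc d)) (+ vₚ (suc d′)) ⟩
    vℚ x ℤ.+ vℚ y ∎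
    where
    open ≡-Reasoning
    nn′≢0 : n ℤ.* n′ ≢ 0ℤ
    nn′≢0 nn′≡0 = [ numerator≢0 x≢0 , numerator≢0 y≢0 ]′ (ℤP.i*j≡0⇒i≡0∨j≡0 n nn′≡0)
    regroup : ∀ a b c d → (a ℤ.+ b) ℤ.- (c ℤ.+ d) ≡ (a ℤ.- c) ℤ.+ (b ℤ.- d)
    regroup = solve-∀

  vℚ-neg : ∀ x → vℚ (- x) ≡ vℚ x
  vℚ-neg (mkℚ -[1+ _ ]   _ _) = refl
  vℚ-neg (mkℚ (+ zero)   _ _) = refl
  vℚ-neg (mkℚ (+ suc _)  _ _) = refl

  vℚ-+ : ∀ x y → x ≢ 0ℚ → y ≢ 0ℚ → x + y ≢ 0ℚ → vℚ x ℤ.≤ vℚ (x + y) ⊎ vℚ y ℤ.≤ vℚ (x + y)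
  vℚ-+ x@(mkℚ n d _) y@(mkℚ n′ d′ _) x≢0 y≢0 x+y≢0 = bound (vℤ-+ a b a≢0 b≢0 a+b≢0)
    where
    a = n ℤ.* + suc d′
    b = n′ ℤ.* + suc d
    a≢0 : a ≢ 0ℤ
    a≢0 a≡0 = [ numerator≢0 x≢0 , (λ ()) ]′ (ℤP.i*j≡0⇒i≡0∨j≡0 n a≡0)
    b≢0 : b ≢ 0ℤ
    b≢0 b≡0 = [ numerator≢0 y≢0 , (λ ()) ]′ (ℤP.i*j≡0⇒i≡0∨j≡0 n′ b≡0)
    a+b≢0 : a ℤ.+ b ≢ 0ℤ
    a+b≢0 a+b≡0 = x+y≢0 (ℚP.toℚᵘ-injective (ℚᵘP.≃-trans (ℚP.toℚᵘ-homo-+ x y)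
      (*≡* (trans (cong (ℤ._* + 1) a+b≡0) (sym (ℤP.*-zeroˡ (+ (suc d ℕ.* suc d′))))))))
    vℚ[x+y] : vℚ (x + y) ≡ + vℤ (a ℤ.+ b) ℤ.- + (vₚ (suc d) ℕ.+ vₚ (suc d′))
    vℚ[x+y] = trans (vℚ-≃ (x + y) (a ℤ.+ b) (d′ ℕ.+ d ℕ.* suc d′) x+y≢0 a+b≢0 (ℚP.toℚᵘ-homo-+ x y))
                    (cong (λ z → + vℤ (a ℤ.+ b) ℤ.- + z) (vₚ-* (suc d) (suc d′) (λ ()) (λ ())))
    w : ℤ
    w = + vℤ (a ℤ.+ b)
    bound : vℤ a ≤ vℤ (a ℤ.+ b) ⊎ vℤ b ≤ vℤ (a ℤ.+ b) → vℚ x ℤ.≤ vℚ (x + y) ⊎ vℚ y ℤ.≤ vℚ (x + y)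
    bound (inj₁ va≤) = inj₁ (subst (vℚ x ℤ.≤_) (sym vℚ[x+y])
      (a+e≤w⇒a-d≤w-[d+e] (+ vℤ n) (+ vₚ (suc d′)) w (+ vₚ (suc d))
        (subst (ℤ._≤ w) (cong +_ (vℤ-* n (+ suc d′) (numerator≢0 x≢0) λ ())) (ℤ.+≤+ va≤))))
    bound (inj₂ vb≤) = inj₂ (subst (vℚ y ℤ.≤_)
      (trans (cong (λ z → w ℤ.- + z) (ℕP.+-comm (vₚ (suc d′)) (vₚ (suc d)))) (sym vℚ[x+y]))
      (a+e≤w⇒a-d≤w-[d+e] (+ vℤ n′) (+ vₚ (suc d)) w (+ vₚ (suc d′))
        (subst (ℤ._≤ w) (cong +_ (vℤ-* n′ (+ suc d) (numerator≢0 y≢0) λ ())) (ℤ.+≤+ vb≤))))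

  vℚ-ℕ : ∀ m → m ≢ 0 → vℚ (ℕtoℚ m) ≡ + vₚ m
  vℚ-ℕ m m≢0 = trans (vℚ-≃ (ℕtoℚ m) (+ m) 0 (ℕtoℚ≢0 m≢0) (λ m≡0 → m≢0 (ℤP.+-injective m≡0)) (ℚP.toℚᵘ-fromℚᵘ (mkℚᵘ (+ m) 0)))
                       (trans (cong (λ z → + vₚ m ℤ.- + z) (vₚ-p^ 0)) (ℤP.+-identityʳ (+ vₚ m)))

  vℚ-1 : vℚ 1ℚ ≡ 0ℤ
  vℚ-1 = ℤP.+-inverseʳ (+ vₚ 1)

padicValuation : (p : ℕ) → Prime p → Valuation
padicValuation p p-prime = record { v = vℚ ; v-* = vℚ-* ; v-neg = vℚ-neg ; v-+ = vℚ-+ }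
  where open PAdic p p-prime

module EisensteinDumas (p : ℕ) (p-prime : Prime p) (k a : ℕ) where
  open PAdic p p-prime using (vℚ; vℚ-1)
  private module D = Degree
  -- Scaling by k makes the slope a/k of the segment from (0 , a) to (k , 0) integral.
  open Newton (scaleValuation k (padicValuation p p-prime)) (+ a) public

  line-ka-k : line (+ k ℤ.* + a) k ≡ 0ℤ
  line-ka-k = trans (line-definition _ k) (trans (cong (λ z → + k ℤ.* + a ℤ.- z) (ℤP.*-comm (+ a) (+ k)))
                                                 (ℤP.+-inverseʳ (+ k ℤ.* + a)))

  line≤ : ∀ s i → line s i ℤ.≤ s
  line≤ s i = subst (ℤ._≤ s) (sym (trans (line-definition s i) (cong (λ z → s ℤ.- z) (sym (ℤP.pos-* a i)))))
                    (ℤP.i≤j⇒i-k≤j (+ (a ℕ.* i)) ℤP.≤-refl)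

  k∣contact : ∀ {g s j} → Coprime k a → LastContact g s j → v (coeff g 0) ≡ s → k ∣ j
  k∣contact {g} {s} {j} k⊥a G vg₀≡s = coprime-divisor k⊥a (+k*z≡+m⇒k∣m k _ (a ℕ.* j) (begin
    + k ℤ.* (vℚ (coeff g 0) ℤ.- vℚ (coeff g j))   ≡⟨ sym (k*x-k*y≡k*[x-y] (+ k) _ _) ⟩
    v (coeff g 0) ℤ.- v (coeff g j)               ≡⟨ cong₂ ℤ._-_ (trans vg₀≡s (sym (line-zero s))) (contact G) ⟩
    line s 0 ℤ.- line s j                         ≡⟨ line-zero-gap s j ⟩
    + a ℤ.* + j                                   ≡⟨ sym (ℤP.pos-* a j) ⟩
    + (a ℕ.* j)                                   ∎))
    where
    open ≡-Reasoning
    k*x-k*y≡k*[x-y] : ∀ k x y → k ℤ.* x ℤ.- k ℤ.* y ≡ k ℤ.* (x ℤ.- y)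
    k*x-k*y≡k*[x-y] = solve-∀

  constant-factor⇒unit : ∀ {g h sg sh jg jh} → jg ℕ.+ jh ≡ k → D.LastContact g sg jg → D.LastContact h sh jh →
                         coeff h k ≢ 0ℚ → IsUnit g
  constant-factor⇒unit {g} {h} {sg} {sh} {jg} {jh} jg+jh≡k G H hₖ≢0 =
    D.lastContact-zero⇒unit (subst (D.LastContact g sg) jg≡0 G)
    where
    jg≡0 : jg ≡ 0
    jg≡0 = ℕP.n≤0⇒n≡0 (ℕP.+-cancelʳ-≤ jh jg 0 (subst (_≤ jh) (sym jg+jh≡k) (D.≤degree H hₖ≢0)))

  factors-units : ∀ {f g h} → Coprime k a → coeff f 0 ≢ 0ℚ → v (coeff f 0) ≡ + k ℤ.* + a →
                  LastContact f (+ k ℤ.* + a) k → D.LastContact f (ℤ.- + k) k →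
                  f ≈ₚ mulP g h → IsUnit g ⊎ IsUnit h
  factors-units {f} {g} {h} k⊥a f₀≢0 vf₀ F Fᵈ f≈gh =
    units (lastContact-exists g₀≢0) (lastContact-exists h₀≢0) (D.lastContact-exists g₀≢0) (D.lastContact-exists h₀≢0)
    where
    gh≈f : mulP g h ≈ₚ f
    gh≈f i = sym (f≈gh i)
    f₀≡g₀h₀ : coeff f 0 ≡ coeff g 0 * coeff h 0
    f₀≡g₀h₀ = trans (f≈gh 0) (coeff-mulP-zero g h)
    g₀≢0 : coeff g 0 ≢ 0ℚ
    g₀≢0 g₀≡0 = f₀≢0 (trans f₀≡g₀h₀ (trans (cong (_* coeff h 0) g₀≡0) (ℚP.*-zeroˡ (coeff h 0))))
    h₀≢0 : coeff h 0 ≢ 0ℚ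
    h₀≢0 h₀≡0 = f₀≢0 (trans f₀≡g₀h₀ (trans (cong (coeff g 0 *_) h₀≡0) (ℚP.*-zeroʳ (coeff g 0))))
    units : ∃₂ (LastContact g) → ∃₂ (LastContact h) → ∃₂ (D.LastContact g) → ∃₂ (D.LastContact h) →
            IsUnit g ⊎ IsUnit h
    units (sg , ig , G) (sh , ih , H) (_ , jg , Gᵈ) (_ , jh , Hᵈ) = [ g-unit , h-unit ]′ ig≡0⊎ig≡k
      where
      ig+ih≡k×sg+sh≡ka = lastContact-unique (lastContact-≈ₚ {mulP g h} gh≈f (lastContact-mulP G H)) F
      ig+ih≡k : ig ℕ.+ ih ≡ k
      ig+ih≡k = proj₁ ig+ih≡k×sg+sh≡ka
      jg+jh≡k : jg ℕ.+ jh ≡ k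
      jg+jh≡k = proj₁ (D.lastContact-unique (D.lastContact-≈ₚ {mulP g h} gh≈f (D.lastContact-mulP Gᵈ Hᵈ)) Fᵈ)
      vg₀≡sg : v (coeff g 0) ≡ sg
      vg₀≡sg = constant-contact-factor G H g₀≢0 h₀≢0
        (trans (cong v (sym f₀≡g₀h₀)) (trans vf₀ (sym (proj₂ ig+ih≡k×sg+sh≡ka))))
      ig≡0⊎ig≡k : ig ≡ 0 ⊎ ig ≡ k
      ig≡0⊎ig≡k = ∣∧≤⇒≡0⊎≡ (k∣contact k⊥a G vg₀≡sg) (subst (ig ≤_) ig+ih≡k (ℕP.m≤m+n ig ih))
      g-unit : ig ≡ 0 → IsUnit g ⊎ IsUnit h
      g-unit refl = inj₁ (constant-factor⇒unit jg+jh≡k Gᵈ Hᵈ (subst (λ i → coeff h i ≢ 0ℚ) ig+ih≡k (contact≢0 H)))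
      h-unit : ig ≡ k → IsUnit g ⊎ IsUnit h
      h-unit refl = inj₂ (constant-factor⇒unit (trans (ℕP.+-comm jh jg) jg+jh≡k) Hᵈ Gᵈ (contact≢0 G))

  irreducible : ∀ {f} → 0 < k → Coprime k a → coeff f k ≡ 1ℚ → (∀ i → k < i → coeff f i ≡ 0ℚ) →
                coeff f 0 ≢ 0ℚ → vℚ (coeff f 0) ≡ + a → Above f (+ k ℤ.* + a) → Irreducible f
  irreducible {f} 0<k k⊥a fₖ≡1 f≡0 f₀≢0 vf₀ f≥ =
    (λ f≈0 → fₖ≢0 (f≈0 k)) ,
    D.lastContact>0⇒¬unit 0<k Fᵈ ,
    λ g h → factors-units {f} {g} {h} k⊥a f₀≢0 (cong (+ k ℤ.*_) vf₀) F Fᵈ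
    where
    fₖ≢0 : coeff f k ≢ 0ℚ
    fₖ≢0 = subst (_≢ 0ℚ) (sym fₖ≡1) ℚP.1≢0
    vfₖ : v (coeff f k) ≡ line (+ k ℤ.* + a) k
    vfₖ = trans (cong (λ x → + k ℤ.* vℚ x) fₖ≡1) (trans (cong (+ k ℤ.*_) vℚ-1) (trans (ℤP.*-zeroʳ (+ k)) (sym line-ka-k)))
    F : LastContact f (+ k ℤ.* + a) k
    F = lastContact-top f≥ fₖ≢0 vfₖ f≡0
    Fᵈ : D.LastContact f (ℤ.- + k) k
    Fᵈ = D.lastContact-degree fₖ≢0 f≡0

module QPolynomial (q n : ℕ) where

  c : ℕ → ℚ
  c l = ℕtoℚ ((q ℕ.∸ 1) ^ l)

  tail : Poly
  tail = foldr addP [] (map (λ l → monomial (c l) (n ℕ.∸ l)) (upTo (suc n)))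

  coeff-QPoly : ∀ i → coeff (QPoly q (2 ℕ.+ n)) i ≡ coeff (monomial 1ℚ (2 ℕ.+ n)) i + - (ℕtoℚ q * coeff tail i)
  coeff-QPoly i = trans (coeff-subP (monomial 1ℚ (2 ℕ.+ n)) (scaleP (ℕtoℚ q) tail) i)
                        (cong (λ z → coeff (monomial 1ℚ (2 ℕ.+ n)) i + - z) (coeff-scaleP (ℕtoℚ q) tail i))

  n<2+n : n < 2 ℕ.+ n
  n<2+n = ℕP.m<n⇒m<1+n (ℕP.n<1+n n)

  coeff-tail-high : ∀ {i} → n < i → coeff tail i ≡ 0ℚ
  coeff-tail-high {i} n<i = coeff-sum-monomials-∉ c (n ℕ.∸_) [] (upTo (suc n))
    (All.universal (λ l n∸l≡i → ℕP.<⇒≱ n<i (subst (_≤ n) n∸l≡i (ℕP.m∸n≤m n l))) _)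

  coeff-tail-zero : coeff tail 0 ≡ c n
  coeff-tail-zero = begin
    coeff tail 0
      ≡⟨ cong (λ L → coeff (foldr addP [] (map term L)) 0) (sym (ListP.upTo-∷ʳ n)) ⟩
    coeff (foldr addP [] (map term (upTo n ++ n ∷ []))) 0
      ≡⟨ cong (λ L → coeff (foldr addP [] L) 0) (ListP.map-++ term (upTo n) (n ∷ [])) ⟩
    coeff (foldr addP [] (map term (upTo n) ++ term n ∷ [])) 0
      ≡⟨ cong (λ P → coeff P 0) (ListP.foldr-++ addP [] (map term (upTo n)) (term n ∷ [])) ⟩
    coeff (foldr addP (addP (term n) []) (map term (upTo n))) 0
      ≡⟨ coeff-sum-monomials-∉ c (n ℕ.∸_) (addP (term n) []) (upTo n)
           (AllP.applyUpTo⁺₁ _ n (λ l<n → ℕP.<⇒≢ (ℕP.m<n⇒0<n∸m l<n) ∘ sym)) ⟩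
    coeff (addP (term n) []) 0
      ≡⟨ trans (coeff-addP (term n) [] 0) (ℚP.+-identityʳ _) ⟩
    coeff (monomial (c n) (n ℕ.∸ n)) 0
      ≡⟨ cong (λ m → coeff (monomial (c n) m) 0) (ℕP.n∸n≡0 n) ⟩
    c n ∎
    where
    open ≡-Reasoning
    term : ℕ → Poly
    term l = monomial (c l) (n ℕ.∸ l)

  coeff-QPoly-top : coeff (QPoly q (2 ℕ.+ n)) (2 ℕ.+ n) ≡ 1ℚ
  coeff-QPoly-top = begin
    coeff (QPoly q (2 ℕ.+ n)) (2 ℕ.+ n)                   ≡⟨ coeff-QPoly (2 ℕ.+ n) ⟩
    coeff (monomial 1ℚ (2 ℕ.+ n)) (2 ℕ.+ n) + - (ℕtoℚ q * coeff tail (2 ℕ.+ n))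
      ≡⟨ cong₂ (λ x y → x + - (ℕtoℚ q * y)) (coeff-monomial-≡ 1ℚ (2 ℕ.+ n)) (coeff-tail-high n<2+n) ⟩
    1ℚ + - (ℕtoℚ q * 0ℚ)                                  ≡⟨ cong (λ z → 1ℚ + - z) (ℚP.*-zeroʳ (ℕtoℚ q)) ⟩
    1ℚ + 0ℚ                                               ≡⟨ ℚP.+-identityʳ 1ℚ ⟩
    1ℚ                                                    ∎
    where open ≡-Reasoning

  coeff-QPoly-high : ∀ i → 2 ℕ.+ n < i → coeff (QPoly q (2 ℕ.+ n)) i ≡ 0ℚ
  coeff-QPoly-high i 2+n<i = begin
    coeff (QPoly q (2 ℕ.+ n)) i                           ≡⟨ coeff-QPoly i ⟩
    coeff (monomial 1ℚ (2 ℕ.+ n)) i + - (ℕtoℚ q * coeff tail i)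
      ≡⟨ cong₂ (λ x y → x + - (ℕtoℚ q * y)) (coeff-monomial-≢ 1ℚ (2 ℕ.+ n) (ℕP.>⇒≢ 2+n<i))
                                             (coeff-tail-high (ℕP.<-trans n<2+n 2+n<i)) ⟩
    0ℚ + - (ℕtoℚ q * 0ℚ)                                  ≡⟨ cong (λ z → 0ℚ + - z) (ℚP.*-zeroʳ (ℕtoℚ q)) ⟩
    0ℚ                                                    ∎
    where open ≡-Reasoning

  coeff-QPoly-zero : coeff (QPoly q (2 ℕ.+ n)) 0 ≡ - (ℕtoℚ q * c n)
  coeff-QPoly-zero = begin
    coeff (QPoly q (2 ℕ.+ n)) 0                           ≡⟨ coeff-QPoly 0 ⟩
    coeff (monomial 1ℚ (2 ℕ.+ n)) 0 + - (ℕtoℚ q * coeff tail 0)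
      ≡⟨ cong (λ y → 0ℚ + - (ℕtoℚ q * y)) coeff-tail-zero ⟩
    0ℚ + - (ℕtoℚ q * c n)                                 ≡⟨ ℚP.+-identityˡ _ ⟩
    - (ℕtoℚ q * c n)                                      ∎
    where open ≡-Reasoning

module QPolynomialValuation (p : ℕ) (p-prime : Prime p) (r n : ℕ) where
  open PAdic p p-prime
  open EisensteinDumas p p-prime (2 ℕ.+ n) r
  open QPolynomial (p ^ r) n

  p^r≢0 : p ^ r ≢ 0
  p^r≢0 = ℕ.≢-nonZero⁻¹ (p ^ r) {{ℕP.m^n≢0 p r}}

  p∤p^r∸1 : 1 ≤ r → ¬ p ∣ p ^ r ℕ.∸ 1
  p∤p^r∸1 (s≤s {n = r′} z≤n) p∣p^r∸1 = p∤1 (ℕD.∣m+n∣m⇒∣n p∣[p^r∸1]+1 p∣p^r∸1)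
    where
    p∣[p^r∸1]+1 : p ∣ p ^ r ℕ.∸ 1 ℕ.+ 1
    p∣[p^r∸1]+1 = subst (p ∣_) (sym (ℕP.m∸n+n≡m (ℕP.n≢0⇒n>0 p^r≢0))) (ℕD.m∣m*n (p ^ r′))

  vℚ-p^r : vℚ (ℕtoℚ (p ^ r)) ≡ + r
  vℚ-p^r = trans (vℚ-ℕ (p ^ r) p^r≢0) (cong +_ (vₚ-p^ r))

  vℚ-c : 1 ≤ r → vℚ (c n) ≡ 0ℤ
  vℚ-c 1≤r = trans (vℚ-ℕ _ (p∤⇒≢0 (p∤m^ n (p∤p^r∸1 1≤r)))) (cong +_ (vₚ-^ n (p∤p^r∸1 1≤r)))

  c≢0 : 1 ≤ r → c n ≢ 0ℚ
  c≢0 1≤r = ℕtoℚ≢0 (p∤⇒≢0 (p∤m^ n (p∤p^r∸1 1≤r)))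

  QPoly₀≢0 : 1 ≤ r → coeff (QPoly (p ^ r) (2 ℕ.+ n)) 0 ≢ 0ℚ
  QPoly₀≢0 1≤r = subst (_≢ 0ℚ) (sym coeff-QPoly-zero) (-x≢0 (x*y≢0 (ℕtoℚ≢0 p^r≢0) (c≢0 1≤r)))

  vℚ-QPoly₀ : 1 ≤ r → vℚ (coeff (QPoly (p ^ r) (2 ℕ.+ n)) 0) ≡ + r
  vℚ-QPoly₀ 1≤r = begin
    vℚ (coeff (QPoly (p ^ r) (2 ℕ.+ n)) 0)   ≡⟨ cong vℚ coeff-QPoly-zero ⟩
    vℚ (- (ℕtoℚ (p ^ r) * c n))              ≡⟨ vℚ-neg (ℕtoℚ (p ^ r) * c n) ⟩
    vℚ (ℕtoℚ (p ^ r) * c n)                  ≡⟨ vℚ-* (ℕtoℚ (p ^ r)) (c n) (ℕtoℚ≢0 p^r≢0) (c≢0 1≤r) ⟩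
    vℚ (ℕtoℚ (p ^ r)) ℤ.+ vℚ (c n)           ≡⟨ cong₂ ℤ._+_ vℚ-p^r (vℚ-c 1≤r) ⟩
    + r ℤ.+ 0ℤ                               ≡⟨ ℤP.+-identityʳ (+ r) ⟩
    + r                                      ∎
    where open ≡-Reasoning

  ℕtoℚ≥ᵥ0 : ∀ m → ℕtoℚ m ≥ᵥ 0ℤ
  ℕtoℚ≥ᵥ0 zero    = inj₁ refl
  ℕtoℚ≥ᵥ0 (suc m) = inj₂ (ℕtoℚ≢0 {suc m} (λ ()) , subst (0ℤ ℤ.≤_) k*v≡ (ℤ.+≤+ z≤n))
    where
    k*v≡ : + ((2 ℕ.+ n) ℕ.* vₚ (suc m)) ≡ + (2 ℕ.+ n) ℤ.* vℚ (ℕtoℚ (suc m))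
    k*v≡ = trans (ℤP.pos-* (2 ℕ.+ n) (vₚ (suc m))) (cong (+ (2 ℕ.+ n) ℤ.*_) (sym (vℚ-ℕ (suc m) λ ())))

  QPoly-above : Above (QPoly (p ^ r) (2 ℕ.+ n)) (+ (2 ℕ.+ n) ℤ.* + r)
  QPoly-above i = subst (_≥ᵥ line kr i) (sym (coeff-QPoly i))
    (≥ᵥ-+ {coeff (monomial 1ℚ (2 ℕ.+ n)) i} leading
      (≥ᵥ-weaken (subst (line kr i ℤ.≤_) (sym (ℤP.+-identityʳ kr)) (line≤ kr i))
                 (≥ᵥ-neg (≥ᵥ-* {ℕtoℚ (p ^ r)} {coeff tail i} p^r≥ tail≥))))
    where
    kr : ℤ
    kr = + (2 ℕ.+ n) ℤ.* + r
    v1≡0 : v 1ℚ ≡ 0ℤ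
    v1≡0 = trans (cong (+ (2 ℕ.+ n) ℤ.*_) vℚ-1) (ℤP.*-zeroʳ (+ (2 ℕ.+ n)))
    leading : coeff (monomial 1ℚ (2 ℕ.+ n)) i ≥ᵥ line kr i
    leading with i ℕ.≟ 2 ℕ.+ n
    ... | yes refl = subst (_≥ᵥ line kr i) (sym (coeff-monomial-≡ 1ℚ (2 ℕ.+ n)))
                       (inj₂ (ℚP.1≢0 , ℤP.≤-reflexive (trans line-ka-k (sym v1≡0))))
    ... | no i≢k   = inj₁ (coeff-monomial-≢ 1ℚ (2 ℕ.+ n) i≢k)
    p^r≥ : ℕtoℚ (p ^ r) ≥ᵥ kr
    p^r≥ = inj₂ (ℕtoℚ≢0 p^r≢0 , ℤP.≤-reflexive (sym (cong (+ (2 ℕ.+ n) ℤ.*_) vℚ-p^r)))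
    tail≥ : coeff tail i ≥ᵥ 0ℤ
    tail≥ = coeff-sum-monomials-≥ᵥ c (n ℕ.∸_) (λ l → ℕtoℚ≥ᵥ0 ((p ^ r ℕ.∸ 1) ^ l)) (upTo (suc n)) i

proposition3p4 : (p r q k : ℕ) → Prime p → 1 ≤ r → q ≡ p ^ r →
    2 ≤ k → gcd k r ≡ 1 → Irreducible (QPoly q k)
proposition3p4 p r .(p ^ r) (suc (suc n)) p-prime 1≤r refl (s≤s (s≤s z≤n)) gcd[k,r]≡1 =
  irreducible {QPoly (p ^ r) (2 ℕ.+ n)} (s≤s z≤n) (gcd≡1⇒coprime gcd[k,r]≡1) coeff-QPoly-top coeff-QPoly-high
              (QPoly₀≢0 1≤r) (vℚ-QPoly₀ 1≤r) QPoly-above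
  where
  open EisensteinDumas p p-prime (2 ℕ.+ n) r
  open QPolynomial (p ^ r) n
  open QPolynomialValuation p p-prime r n
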